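{- Let $\lambda(G)$ be a temporal graph, where $G=(V,E)$ is a (directed or undirected) graph, and let $s,v\in V$. Then the maximum number of pairwise in-disjoint journeys from $s$ to $v$ is equal to the minimum number of node arrival times needed to separate $s$ from $v$.
   Context: A labeling of a (di)graph $G=(V,E)$ is a map $\lambda:E\to 2^{\mathbb{N}}$ assigning to each edge a finite (possibly empty) set of natural numbers (labels); $\lambda(G)$ is a temporal graph. A time-edge is a triple $(u,w,t)$ with $(u,w)$ an edge (for undirected graphs, traversed from $u$ to $w$) and $t$ a label of that edge; it leaves $u$ and arrives at $w$ at time $t$. A journey from $s$ to $v$ is a path $(e_1,\dots,e_k)$ of $G$ from $s$ to $v$ together with labels $l_1<\dots<l_k$, $l_i\in\lambda(e_i)$. Two journeys are in-disjoint if they never arrive at the same node at the same time. Removing the node arrival time $(u,t)$ means deleting all time-edges that arrive at $u$ at time $t$ (removing label $t$ from all edges entering $u$). The minimum number of node arrival times needed to separate $s$ from $v$ is the smallest number of node arrival times whose removal leaves no journey from $s$ to $v$. -}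

module Defs where

open import Data.Nat using (ℕ; _<_; _≤_)
open import Data.Fin using (Fin)
open import Data.Bool using (Bool; T)
open import Data.List using (List; []; _∷_; map; length)
open import Data.List.Membership.Propositional using (_∈_; _∉_)
open import Data.List.Relation.Unary.All using (All)
open import Data.List.Relation.Unary.AllPairs using (AllPairs)
open import Data.List.Relation.Unary.Linked using (Linked)
open import Data.List.Relation.Unary.Unique.Propositional using (Unique)
open import Data.Product using (Σ; ∃; _×_; _,_; proj₁; proj₂)
open import Relation.Binary.PropositionalEquality using (_≡_)
open import Relation.Nullary using (¬_)

data GraphKind : Set where
  directed undirected : GraphKind

-- Adj u w = true  iff  (u,w) ∈ E  (for undirected graphs Adj is symmetric:
-- the undirected edge {u,w} is represented by Adj u w = Adj w u = true).
-- label u w e is the finite set λ((u,w)) of labels of that edge; for an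
-- undirected graph both orientations carry the same label set (it is one edge).
record TemporalGraph (n : ℕ) : Set where
  field
    kind      : GraphKind
    Adj       : Fin n → Fin n → Bool
    label     : (u w : Fin n) → T (Adj u w) → List ℕ
    adj-sym   : kind ≡ undirected → ∀ {u w} → T (Adj u w) → T (Adj w u)
    label-sym : (k : kind ≡ undirected) → ∀ {u w} (e : T (Adj u w)) →
                label w u (adj-sym k e) ≡ label u w e

module _ {n : ℕ} (G : TemporalGraph n) where
  open TemporalGraph G

  NodeTime : Set
  NodeTime = Fin n × ℕ

  Step : Set
  Step = Fin n × Fin n × ℕ

  source target : Step → Fin n
  source (u , _ , _) = u
  target (_ , w , _) = w

  time : Step → ℕ
  time (_ , _ , t) = t

  arrival : Step → NodeTime
  arrival (_ , w , t) = (w , t)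

  TimeEdge : Fin n → Fin n → ℕ → Set
  TimeEdge u w t = Σ (T (Adj u w)) λ e → t ∈ label u w e

  data Chain : Fin n → Fin n → List Step → Set where
    []  : ∀ {u} → Chain u u []
    _∷_ : ∀ {u w v t xs} → TimeEdge u w t → Chain w v xs →
          Chain u v ((u , w , t) ∷ xs)

  -- A journey from s to v in the temporal graph obtained from λ(G) by
  -- removing the node arrival times in X (i.e. deleting every time-edge that
  -- arrives at u at time t, for (u , t) ∈ X):
  -- a path of G (no repeated vertex) with strictly increasing labels,
  -- all of whose time-edges survive the removal.
  JourneyAvoiding : List NodeTime → Fin n → Fin n → List Step → Set
  JourneyAvoiding X s v xs =
    Chain s v xs
    × Linked _<_ (map time xs)
    × Unique (s ∷ map target xs)
    × All (λ st → arrival st ∉ X) xs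

  Journey : Fin n → Fin n → List Step → Set
  Journey = JourneyAvoiding []

  InDisjoint : List Step → List Step → Set
  InDisjoint xs ys = ∀ a → a ∈ map arrival xs → a ∉ map arrival ys

  InDisjointJourneys : Fin n → Fin n → List (List Step) → Set
  InDisjointJourneys s v js = All (Journey s v) js × AllPairs InDisjoint js

  Separates : List NodeTime → Fin n → Fin n → Set
  Separates X s v = ∀ xs → ¬ JourneyAvoiding X s v xs

  IsMaxInDisjoint : Fin n → Fin n → ℕ → Set
  IsMaxInDisjoint s v k =
    (∃ λ js → InDisjointJourneys s v js × length js ≡ k)
    × (∀ js → InDisjointJourneys s v js → length js ≤ k)

  IsMinSeparator : Fin n → Fin n → ℕ → Set
  IsMinSeparator s v k =
    (∃ λ X → Separates X s v × length X ≡ k)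
    × (∀ X → Separates X s v → k ≤ length X)

module Submission where

-- The proof is the classical reduction to the static vertex version of
-- Menger's theorem.  The static expansion of λ(G) has the node arrival times
-- (w , t) as vertices and an edge (u , t) → (w , t') for every time-edge
-- (u , w , t') with t < t'; its sources are the arrivals of time-edges
-- leaving s and its sinks the arrivals at v.  A journey from s to v is a
-- source–sink walk through exactly its node arrival times, and conversely
-- every source–sink walk contains the arrivals of a journey (loop erasure).
-- In-disjoint journeys thus correspond to vertex-disjoint walks, and
-- separating sets of node arrival times to vertex separators.

open import Defs
open import Data.Bool using (Bool; true; false; T)
open import Data.Empty using (⊥; ⊥-elim)
open import Data.Fin as Fin using (Fin)
open import Data.List using (List; []; _∷_; _++_; [_]; length; map; filter; deduplicate;
                             concatMap; cartesianProduct; allFin)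
open import Data.List.Properties using (length-++; length-map)
import Data.List.Membership.DecPropositional as DecMembership
open import Data.List.Membership.Propositional using (_∈_; _∉_; mapWith∈; find)
open import Data.List.Membership.Propositional.Properties
  using (∈-∃++; ∈-++⁺ˡ; ∈-++⁺ʳ; ∈-++⁻; ∈-filter⁺; ∈-filter⁻; ∈-deduplicate⁺; ∈-deduplicate⁻;
         ∈-map⁺; ∈-map⁻; ∈-concatMap⁺; ∈-cartesianProduct⁺; ∈-allFin)
open import Data.List.Membership.Setoid.Properties using (length-mapWith∈)
open import Data.List.Relation.Binary.Disjoint.Propositional using (Disjoint)
import Data.List.Relation.Binary.Disjoint.Propositional.Properties as Disjoint
open import Data.List.Relation.Binary.Subset.Propositional using (_⊆_)
open import Data.List.Relation.Binary.Subset.Propositional.Properties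
  using (∷⁺ʳ; ∈-∷⁺ʳ) renaming (map⁺ to map-⊆)
open import Data.List.Relation.Unary.All as All using (All; []; _∷_)
open import Data.List.Relation.Unary.All.Properties
  using (¬Any⇒All¬; anti-mono; map⁺; map⁻) renaming (++⁺ to All-++⁺)
open import Data.List.Relation.Unary.AllPairs as AllPairs using (AllPairs; []; _∷_)
import Data.List.Relation.Unary.AllPairs.Properties as AllPairs
open import Data.List.Relation.Unary.Any as Any using (here; there; any?)
open import Data.List.Relation.Unary.Linked as Linked using (Linked; []; [-]; _∷_)
open import Data.List.Relation.Unary.Linked.Properties using (Linked⇒All)
open import Data.List.Relation.Unary.Unique.Propositional using (Unique)
open import Data.List.Relation.Unary.Unique.DecPropositional.Properties using (deduplicate-!)
open import Data.Nat as ℕ using (ℕ; suc; _≤_; _<_; _≤?_; _<?_; z≤n; s≤s)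
open import Data.Nat.Properties using (+-suc; 1+n≰n; ≤-antisym; ≰⇒>; <-trans)
open import Data.Product using (Σ; ∃; ∃₂; _×_; _,_; proj₁; proj₂)
open import Data.Product.Properties using (≡-dec)
open import Data.Sum using (_⊎_; inj₁; inj₂)
open import Data.Unit using (tt)
open import Function using (_on_; _∘_; id)
open import Relation.Binary using (DecidableEquality; Symmetric)
open import Relation.Binary.PropositionalEquality using (_≡_; _≢_; refl; sym; trans; cong; subst; setoid)
open import Relation.Nullary using (Dec; yes; no)
open import Relation.Nullary.Decidable using (_×-dec_)

module _ {A : Set} where

  Meets : List A → List A → Set
  Meets xs ys = ∃ λ u → u ∈ xs × u ∈ ys

  Meets-⊆ : ∀ {xs xs' ys : List A} → xs ⊆ xs' → Meets xs ys → Meets xs' ys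
  Meets-⊆ ⊆xs' (u , u∈xs , u∈ys) = u , ⊆xs' u∈xs , u∈ys

  Disjoint-⊆ : ∀ {xs xs' ys ys' : List A} → xs' ⊆ xs → ys' ⊆ ys → Disjoint xs ys → Disjoint xs' ys'
  Disjoint-⊆ xs'⊆ ys'⊆ xs#ys (u∈xs' , u∈ys') = xs#ys (xs'⊆ u∈xs' , ys'⊆ u∈ys')

  Disjoint-++ : ∀ {xs xs' ys ys' : List A} → Disjoint xs ys → Disjoint xs ys' →
                Disjoint xs' ys → Disjoint xs' ys' → Disjoint (xs ++ xs') (ys ++ ys')
  Disjoint-++ {xs} {xs'} {ys} {ys'} d₁ d₂ d₃ d₄ (u∈l , u∈r) with ∈-++⁻ xs u∈l | ∈-++⁻ ys u∈r
  ... | inj₁ u∈xs  | inj₁ u∈ys  = d₁ (u∈xs , u∈ys)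
  ... | inj₁ u∈xs  | inj₂ u∈ys' = d₂ (u∈xs , u∈ys')
  ... | inj₂ u∈xs' | inj₁ u∈ys  = d₃ (u∈xs' , u∈ys)
  ... | inj₂ u∈xs' | inj₂ u∈ys' = d₄ (u∈xs' , u∈ys')

  disjoint-shrink : ∀ {C D : Set} {f : C → List A} {g : D → List A} (h : C → D) →
                    (∀ c → g (h c) ⊆ f c) → ∀ {Cs} → AllPairs (Disjoint on f) Cs →
                    AllPairs (Disjoint on g) (map h Cs)
  disjoint-shrink h shrinks =
    AllPairs.map⁺ ∘ AllPairs.map (λ {c} {d} → Disjoint-⊆ (shrinks c) (shrinks d))

  ∈-remove : ∀ us {ws} {u v : A} → v ∈ us ++ u ∷ ws → v ≢ u → v ∈ us ++ ws
  ∈-remove us v∈ v≢u with ∈-++⁻ us v∈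
  ... | inj₁ v∈us         = ∈-++⁺ˡ v∈us
  ... | inj₂ (here v≡u)   = ⊥-elim (v≢u v≡u)
  ... | inj₂ (there v∈ws) = ∈-++⁺ʳ us v∈ws

  length-remove : ∀ us {ws} {u : A} → length (us ++ u ∷ ws) ≡ suc (length (us ++ ws))
  length-remove us {ws} = trans (length-++ us) (trans (+-suc (length us) (length ws))
                                                      (cong suc (sym (length-++ us))))

  AllPairs-∈ : ∀ {R : A → A → Set} {xs x y} → Symmetric R → AllPairs R xs →
               x ∈ xs → y ∈ xs → x ≢ y → R x y
  AllPairs-∈ R-sym _         (here refl) (here refl) x≢y = ⊥-elim (x≢y refl)
  AllPairs-∈ R-sym (Rx ∷ _)  (here refl) (there y∈)  _   = All.lookup Rx y∈
  AllPairs-∈ R-sym (Rx ∷ _)  (there x∈)  (here refl) _   = R-sym (All.lookup Rx x∈)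
  AllPairs-∈ R-sym (_ ∷ Rxs) (there x∈)  (there y∈)  x≢y = AllPairs-∈ R-sym Rxs x∈ y∈ x≢y

  mapWith∈-All : ∀ {B : Set} {P : B → Set} (xs : List A) (g : ∀ {x} → x ∈ xs → B) →
                 (∀ {x} (x∈ : x ∈ xs) → P (g x∈)) → All P (mapWith∈ xs g)
  mapWith∈-All []       g Pg = []
  mapWith∈-All (x ∷ xs) g Pg = Pg (here refl) ∷ mapWith∈-All xs (g ∘ there) (Pg ∘ there)

  mapWith∈-AllPairs : ∀ {B : Set} {R : B → B → Set} (xs : List A) (g : ∀ {x} → x ∈ xs → B) → Unique xs →
                      (∀ {x y} (x∈ : x ∈ xs) (y∈ : y ∈ xs) → x ≢ y → R (g x∈) (g y∈)) →
                      AllPairs R (mapWith∈ xs g)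
  mapWith∈-AllPairs []       g []             Rg = []
  mapWith∈-AllPairs (x ∷ xs) g (x∉xs ∷ uniq) Rg =
    mapWith∈-All xs (g ∘ there) (λ y∈ → Rg (here refl) (there y∈) (All.lookup x∉xs y∈))
    ∷ mapWith∈-AllPairs xs (g ∘ there) uniq (λ x∈ y∈ → Rg (there x∈) (there y∈))

  module _ {C : Set} (f : C → List A) where

    disjoint-meeting-≤ : ∀ L {Cs} → AllPairs (Disjoint on f) Cs →
                         All (λ c → Meets (f c) L) Cs → length Cs ≤ length L
    disjoint-meeting-≤ L         []               []                        = z≤n
    disjoint-meeting-≤ L {c ∷ _} (c#Cs ∷ disjoint) ((u , u∈c , u∈L) ∷ meets) with ∈-∃++ u∈L
    ... | us , ws , refl =
      subst (_ ≤_) (sym (length-remove us))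
        (s≤s (disjoint-meeting-≤ (us ++ ws) disjoint (All.zipWith meets-rest (c#Cs , meets))))
      where
      meets-rest : ∀ {d} → Disjoint (f c) (f d) × Meets (f d) (us ++ u ∷ ws) → Meets (f d) (us ++ ws)
      meets-rest (c#d , w , w∈d , w∈L) = w , w∈d , ∈-remove us w∈L (λ { refl → c#d (u∈c , w∈d) })

    disjoint-meeting-onto : DecidableEquality A → (pt : C → A) → ∀ L {Cs} →
                            AllPairs (Disjoint on f) Cs → All (λ c → pt c ∈ f c × pt c ∈ L) Cs →
                            length Cs ≡ length L → ∀ {z} → z ∈ L → ∃ λ c → c ∈ Cs × pt c ≡ z
    disjoint-meeting-onto _≟_ pt L {Cs} disjoint chosen |Cs|≡|L| {z} z∈L
      with any? (λ c → pt c ≟ z) Cs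
    ... | yes hit = find hit
    ... | no miss with ∈-∃++ z∈L
    ...   | us , ws , refl = ⊥-elim (1+n≰n too-many)
      where
      -- If z is not chosen, all the Cs meet L without z, contradicting pigeonhole.
      avoid-z : ∀ {c} → (pt c ∈ f c × pt c ∈ us ++ z ∷ ws) × pt c ≢ z → Meets (f c) (us ++ ws)
      avoid-z ((p∈c , p∈L) , p≢z) = pt _ , p∈c , ∈-remove us p∈L p≢z

      too-many : suc (length (us ++ ws)) ≤ length (us ++ ws)
      too-many = subst (_≤ length (us ++ ws)) (trans |Cs|≡|L| (length-remove us))
                   (disjoint-meeting-≤ (us ++ ws) disjoint (All.zipWith avoid-z (chosen , ¬Any⇒All¬ Cs miss)))

-- Menger's theorem for vertex-disjoint A–B walks in a finite digraph whose
-- edges are listed in E, proved by induction on E (Göring's argument).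
module Menger {V : Set} (_≟_ : DecidableEquality V) where

  open import Data.List.Membership.DecPropositional _≟_ using (_∈?_)

  Edges : Set
  Edges = List (V × V)

  data Walk (E : Edges) : V → V → List V → Set where
    done : ∀ {a} → Walk E a a [ a ]
    step : ∀ {a b c ws} → (a , b) ∈ E → Walk E b c ws → Walk E a c (a ∷ ws)

  WalkWithin : Edges → V → V → List V → Set
  WalkWithin E a b ws = ∃ λ vs → Walk E a b vs × vs ⊆ ws

  module _ {E : Edges} where

    start∈ : ∀ {a b ws} → Walk E a b ws → a ∈ ws
    start∈ done       = here refl
    start∈ (step _ _) = here refl

    end∈ : ∀ {a b ws} → Walk E a b ws → b ∈ ws
    end∈ done       = here refl
    end∈ (step _ w) = there (end∈ w)

    weaken : ∀ {e a b ws} → Walk E a b ws → Walk (e ∷ E) a b ws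
    weaken done       = done
    weaken (step e w) = step (there e) (weaken w)

    prefix-to : ∀ {a b u ws} → Walk E a b ws → u ∈ ws → WalkWithin E a u ws
    prefix-to done       (here refl) = _ , done , id
    prefix-to done       (there ())
    prefix-to (step _ _) (here refl) = _ , done , ∷⁺ʳ _ (λ ())
    prefix-to (step e w) (there u∈) with prefix-to w u∈
    ... | vs , w' , vs⊆ = _ , step e w' , ∷⁺ʳ _ vs⊆

    suffix-from : ∀ {a b u ws} → Walk E a b ws → u ∈ ws → WalkWithin E u b ws
    suffix-from done       (here refl) = _ , done , id
    suffix-from done       (there ())
    suffix-from (step e w) (here refl) = _ , step e w , id
    suffix-from (step e w) (there u∈) with suffix-from w u∈
    ... | vs , w' , vs⊆ = vs , w' , there ∘ vs⊆

    concat-at : ∀ {a u b ws vs} → Walk E a u ws → Walk E u b vs → WalkWithin E a b (ws ++ vs)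
    concat-at done       w₂ = _ , w₂ , there
    concat-at (step e w) w₂ with concat-at w w₂
    ... | zs , w' , zs⊆ = _ , step e w' , ∷⁺ʳ _ zs⊆

    bridge : ∀ {a x y b ws vs} → Walk E a x ws → (x , y) ∈ E → Walk E y b vs → Walk E a b (ws ++ vs)
    bridge done       e w₂ = step e w₂
    bridge (step d w) e w₂ = step d (bridge w e w₂)

    recast : ∀ {a a' b b' ws} → a ≡ a' → b ≡ b' → Walk E a b ws → Walk E a' b' ws
    recast refl refl w = w

  Blocks : Edges → List V → List V → List V → Set
  Blocks E A B X = ∀ {a b ws} → Walk E a b ws → a ∈ A → b ∈ B → Meets ws X

  no-avoiding-walk : ∀ {E A B X a b ws} → Blocks E A B X → a ∈ A → b ∈ B →
                     WalkWithin E a b ws → All (_∉ X) ws → ⊥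
  no-avoiding-walk X-blocks a∈A b∈B (vs , w , vs⊆) avoids with X-blocks w a∈A b∈B
  ... | u , u∈vs , u∈X = All.lookup avoids (vs⊆ u∈vs) u∈X

  ends-block : ∀ {E A Z X} → Z ⊆ X → Blocks E A Z X
  ends-block Z⊆X w _ b∈Z = _ , end∈ w , Z⊆X b∈Z

  starts-block : ∀ {E Z B X} → Z ⊆ X → Blocks E Z B X
  starts-block Z⊆X w a∈Z _ = _ , start∈ w , Z⊆X a∈Z

  record Link (E : Edges) (A B : List V) : Set where
    constructor link
    field
      start end : V
      verts     : List V
      walk      : Walk E start end verts
      start∈A   : start ∈ A
      end∈B     : end ∈ B
  open Link public

  _#_ : ∀ {E A B} → Link E A B → Link E A B → Set
  _#_ = Disjoint on verts

  weak-duality : ∀ {E A B X} {Ls : List (Link E A B)} → Blocks E A B X →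
                 AllPairs _#_ Ls → length Ls ≤ length X
  weak-duality X-blocks disjoint =
    disjoint-meeting-≤ verts _ disjoint (All.tabulate λ {l} _ → X-blocks (walk l) (start∈A l) (end∈B l))

  -- Menger's theorem for (E, A, B): a duplicate-free separator and a family of
  -- pairwise disjoint links of the same size.  By weak duality both are extremal.
  record MengerPair (E : Edges) (A B : List V) : Set where
    field
      separator        : List V
      blocks           : Blocks E A B separator
      separator-unique : Unique separator
      links            : List (Link E A B)
      links-disjoint   : AllPairs _#_ links
      same-size        : length links ≡ length separator

  -- Without edges the walks are single vertices: A ∩ B is the answer.
  menger-base : ∀ A B → MengerPair [] A B
  menger-base A B = record
    { separator        = X
    ; blocks           = X-blocks
    ; separator-unique = deduplicate-! _≟_ (filter (_∈? B) A)
    ; links            = mapWith∈ X trivial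
    ; links-disjoint   = mapWith∈-AllPairs X trivial (deduplicate-! _≟_ (filter (_∈? B) A))
                           λ _ _ z≢z' → λ { (here refl , here refl) → z≢z' refl }
    ; same-size        = length-mapWith∈ (setoid V) X
    }
    where
    X : List V
    X = deduplicate _≟_ (filter (_∈? B) A)

    in-both : ∀ {z} → z ∈ X → z ∈ A × z ∈ B
    in-both z∈X = ∈-filter⁻ (_∈? B) (∈-deduplicate⁻ _≟_ (filter (_∈? B) A) z∈X)

    trivial : ∀ {z} → z ∈ X → Link [] A B
    trivial {z} z∈X = link z z [ z ] done (proj₁ (in-both z∈X)) (proj₂ (in-both z∈X))

    X-blocks : Blocks [] A B X
    X-blocks done       a∈A a∈B = _ , here refl , ∈-deduplicate⁺ _≟_ (∈-filter⁺ (_∈? B) a∈A a∈B)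
    X-blocks (step () _) _   _

  data AvoidsBeforeEnd (Z : List V) : List V → Set where
    last : ∀ {a} → AvoidsBeforeEnd Z [ a ]
    skip : ∀ {a ws} → a ∉ Z → AvoidsBeforeEnd Z ws → AvoidsBeforeEnd Z (a ∷ ws)

  data AvoidsAfterStart (Z : List V) : List V → Set where
    first : ∀ {a ws} → All (_∉ Z) ws → AvoidsAfterStart Z (a ∷ ws)

  record Front (E : Edges) (A Z : List V) : Set where
    constructor front
    field
      as-link  : Link E A Z
      only-end : AvoidsBeforeEnd Z (verts as-link)

  record Back (E : Edges) (Z B : List V) : Set where
    constructor back
    field
      as-link    : Link E Z B
      only-start : AvoidsAfterStart Z (verts as-link)

  front-verts : ∀ {E A Z} → Front E A Z → List V
  front-verts = verts ∘ Front.as-link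

  front-end : ∀ {E A Z} → Front E A Z → V
  front-end = end ∘ Front.as-link

  back-verts : ∀ {E Z B} → Back E Z B → List V
  back-verts = verts ∘ Back.as-link

  back-start : ∀ {E Z B} → Back E Z B → V
  back-start = start ∘ Back.as-link

  module _ {E : Edges} {Z : List V} where

    only-at-end : ∀ {a b ws u} → AvoidsBeforeEnd Z ws → Walk E a b ws → u ∈ ws → u ∈ Z → u ≡ b
    only-at-end last         done       (here refl) _   = refl
    only-at-end (skip a∉Z _) (step _ _) (here refl) u∈Z = ⊥-elim (a∉Z u∈Z)
    only-at-end (skip _ av)  (step _ w) (there u∈)  u∈Z = only-at-end av w u∈ u∈Z
    only-at-end (skip _ ())  done       _           _

    only-at-start : ∀ {a b ws u} → AvoidsAfterStart Z ws → Walk E a b ws → u ∈ ws → u ∈ Z → u ≡ a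
    only-at-start _           done       (here refl) _   = refl
    only-at-start _           (step _ _) (here refl) _   = refl
    only-at-start (first avs) _          (there u∈)  u∈Z = ⊥-elim (All.lookup avs u∈ u∈Z)

    prefix-avoiding : ∀ {X a b ws u} → X ⊆ Z → AvoidsBeforeEnd Z ws → Walk E a b ws →
                      u ∈ ws → u ∉ X → ∃ λ pre → Walk E a u pre × All (_∉ X) pre
    prefix-avoiding X⊆Z last         done       (here refl) u∉X = _ , done , u∉X ∷ []
    prefix-avoiding X⊆Z (skip _ _)   (step _ _) (here refl) u∉X = _ , done , u∉X ∷ []
    prefix-avoiding X⊆Z (skip a∉Z av) (step e w) (there u∈) u∉X with prefix-avoiding X⊆Z av w u∈ u∉X
    ... | pre , w' , avoids = _ , step e w' , (a∉Z ∘ X⊆Z) ∷ avoids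
    prefix-avoiding X⊆Z (skip _ ())  done       _           _

    suffix-avoiding : ∀ {X a b ws u} → X ⊆ Z → AvoidsAfterStart Z ws → Walk E a b ws →
                      u ∈ ws → u ∉ X → ∃ λ suf → Walk E u b suf × All (_∉ X) suf
    suffix-avoiding X⊆Z (first avs) done       (here refl) u∉X = _ , done , u∉X ∷ []
    suffix-avoiding X⊆Z (first avs) (step e w) (here refl) u∉X =
      _ , step e w , u∉X ∷ All.map (_∘ X⊆Z) avs
    suffix-avoiding X⊆Z (first avs) (step e w) (there u∈)  u∉X with suffix-from w u∈
    ... | suf , w' , suf⊆ = suf , w' , anti-mono suf⊆ (All.map (_∘ X⊆Z) avs)

    cut-at-first : ∀ {a b ws} → Walk E a b ws → b ∈ Z →
                   ∃₂ λ b' ws' → Walk E a b' ws' × b' ∈ Z × AvoidsBeforeEnd Z ws' × ws' ⊆ ws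
    cut-at-first {a} w b∈Z with a ∈? Z
    ... | yes a∈Z = a , [ a ] , done , a∈Z , last , λ { (here refl) → start∈ w }
    cut-at-first done       b∈Z | no a∉Z = ⊥-elim (a∉Z b∈Z)
    cut-at-first (step e w) b∈Z | no a∉Z with cut-at-first w b∈Z
    ... | b' , ws' , w' , b'∈Z , av , ws'⊆ = b' , _ , step e w' , b'∈Z , skip a∉Z av , ∷⁺ʳ _ ws'⊆

    cut-at-last : ∀ {a b ws} → Walk E a b ws →
                  (∃₂ λ a' ws' → Walk E a' b ws' × a' ∈ Z × AvoidsAfterStart Z ws' × ws' ⊆ ws)
                  ⊎ All (_∉ Z) ws
    cut-at-last {a} done with a ∈? Z
    ... | yes a∈Z = inj₁ (a , _ , done , a∈Z , first [] , id)
    ... | no a∉Z  = inj₂ (a∉Z ∷ [])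
    cut-at-last {a} (step e w) with cut-at-last w
    ... | inj₁ (a' , ws' , w' , a'∈Z , av , ws'⊆) = inj₁ (a' , ws' , w' , a'∈Z , av , there ∘ ws'⊆)
    ... | inj₂ avoids with a ∈? Z
    ...   | yes a∈Z = inj₁ (a , _ , step e w , a∈Z , first avoids , id)
    ...   | no a∉Z  = inj₂ (a∉Z ∷ avoids)

  first-entry : ∀ {E A Z} (l : Link E A Z) → Σ (Front E A Z) λ f → front-verts f ⊆ verts l
  first-entry (link a b ws w a∈A b∈Z) with cut-at-first w b∈Z
  ... | b' , ws' , w' , b'∈Z , av , ws'⊆ = front (link a b' ws' w' a∈A b'∈Z) av , ws'⊆

  last-exit : ∀ {E Z B} (l : Link E Z B) → Σ (Back E Z B) λ k → back-verts k ⊆ verts l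
  last-exit (link a b ws w a∈Z b∈B) with cut-at-last w
  ... | inj₁ (a' , ws' , w' , a'∈Z , av , ws'⊆) = back (link a' b ws' w' a'∈Z b∈B) av , ws'⊆
  ... | inj₂ avoids = ⊥-elim (All.lookup avoids (start∈ w) a∈Z)

  -- Let S be a minimum A–B
  -- separator in E, and let T₁ (resp. T₂) be a minimum separator in E between
  -- A and x ∷ S (resp. y ∷ S and B).  Both T₁ and T₂ separate A from B in E⁺,
  -- and |S| ≤ |Tᵢ| ≤ |S| + 1.  If some |Tᵢ| = |S|, the links of S still work;
  -- otherwise x, y ∉ S and the links for T₁ and T₂ glue along x ∷ S ≅ y ∷ S
  -- (x with y through the new edge, each s ∈ S with itself) to |S| + 1
  -- disjoint links in E⁺.
  module InductionStep (x y : V) {E : Edges} {A B : List V} (M : MengerPair E A B)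
              (M₁ : MengerPair E A (x ∷ MengerPair.separator M))
              (M₂ : MengerPair E (y ∷ MengerPair.separator M) B) where

    open MengerPair M using () renaming
      (separator to S; blocks to S-blocks; separator-unique to S-unique; links to P;
       links-disjoint to P-disjoint; same-size to |P|≡|S|)
    open MengerPair M₁ using () renaming
      (separator to T₁; blocks to T₁-blocks-E; separator-unique to T₁-unique;
       links to Q₁; links-disjoint to Q₁-disjoint; same-size to |Q₁|≡|T₁|)
    open MengerPair M₂ using () renaming
      (separator to T₂; blocks to T₂-blocks-E; separator-unique to T₂-unique;
       links to Q₂; links-disjoint to Q₂-disjoint; same-size to |Q₂|≡|T₂|)

    E⁺ : Edges
    E⁺ = (x , y) ∷ E

    until-x : ∀ {a b ws} → Walk E⁺ a b ws → Walk E a b ws ⊎ WalkWithin E a x ws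
    until-x done                 = inj₁ done
    until-x (step (here refl) _) = inj₂ (_ , done , ∷⁺ʳ _ (λ ()))
    until-x (step (there e) w) with until-x w
    ... | inj₁ w'               = inj₁ (step e w')
    ... | inj₂ (vs , w' , vs⊆) = inj₂ (_ , step e w' , ∷⁺ʳ _ vs⊆)

    after-y : ∀ {a b ws} → Walk E⁺ a b ws → Walk E a b ws ⊎ WalkWithin E y b ws
    after-y done = inj₁ done
    after-y (step e w) with after-y w | e
    ... | inj₂ (vs , w' , vs⊆) | _         = inj₂ (vs , w' , there ∘ vs⊆)
    ... | inj₁ w'              | here refl = inj₂ (_ , w' , there)
    ... | inj₁ w'              | there e'  = inj₁ (step e' w')

    T₁-blocks : Blocks E⁺ A B T₁
    T₁-blocks w a∈A b∈B with until-x w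
    ... | inj₂ (vs , w' , vs⊆) = Meets-⊆ vs⊆ (T₁-blocks-E w' a∈A (here refl))
    ... | inj₁ w' with S-blocks w' a∈A b∈B
    ...   | u , u∈ws , u∈S with prefix-to w' u∈ws
    ...     | vs , w'' , vs⊆ = Meets-⊆ vs⊆ (T₁-blocks-E w'' a∈A (there u∈S))

    T₂-blocks : Blocks E⁺ A B T₂
    T₂-blocks w a∈A b∈B with after-y w
    ... | inj₂ (vs , w' , vs⊆) = Meets-⊆ vs⊆ (T₂-blocks-E w' (here refl) b∈B)
    ... | inj₁ w' with S-blocks w' a∈A b∈B
    ...   | u , u∈ws , u∈S with suffix-from w' u∈ws
    ...     | vs , w'' , vs⊆ = Meets-⊆ vs⊆ (T₂-blocks-E w'' (there u∈S) b∈B)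

    P⁺ : List (Link E⁺ A B)
    P⁺ = map (λ l → link (start l) (end l) (verts l) (weaken (walk l)) (start∈A l) (end∈B l)) P

    |P⁺|≡|S| : length P⁺ ≡ length S
    |P⁺|≡|S| = trans (length-map _ P) |P|≡|S|

    from-small-separator : ∀ {T} → Blocks E⁺ A B T → Unique T → length T ≤ length S →
                           MengerPair E⁺ A B
    from-small-separator {T} T-blocks T-unique |T|≤|S| = record
      { separator        = T
      ; blocks           = T-blocks
      ; separator-unique = T-unique
      ; links            = P⁺
      ; links-disjoint   = AllPairs.map⁺ P-disjoint
      ; same-size        = trans |P⁺|≡|S|
          (≤-antisym (subst (_≤ length T) |P⁺|≡|S| (weak-duality T-blocks (AllPairs.map⁺ P-disjoint)))
                     |T|≤|S|)
      }

    -- The links for T₁ end in x ∷ S, those for T₂ start in y ∷ S.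
    |T₁|≤|x∷S| : ∀ {X} → x ∷ S ⊆ X → length T₁ ≤ length X
    |T₁|≤|x∷S| x∷S⊆X = subst (_≤ _) |Q₁|≡|T₁| (weak-duality (ends-block x∷S⊆X) Q₁-disjoint)

    |T₂|≤|y∷S| : ∀ {X} → y ∷ S ⊆ X → length T₂ ≤ length X
    |T₂|≤|y∷S| y∷S⊆X = subst (_≤ _) |Q₂|≡|T₂| (weak-duality (starts-block y∷S⊆X) Q₂-disjoint)

    absorb : ∀ {z} → z ∈ S → z ∷ S ⊆ S
    absorb z∈S (here refl) = z∈S
    absorb z∈S (there u∈S) = u∈S

    -- A front into x ∷ S and a back out of y ∷ S meet only if the end of the
    -- former is the start of the latter: a common vertex outside S would
    -- give an A–B walk in E avoiding S.
    crossing : (f : Front E A (x ∷ S)) (k : Back E (y ∷ S) B) → front-end f ≢ back-start k →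
               Disjoint (front-verts f) (back-verts k)
    crossing (front lf only-end) (back lk only-start) end≢start {u} (u∈f , u∈k) with u ∈? S
    ... | yes u∈S = end≢start (trans (sym (only-at-end only-end (walk lf) u∈f (there u∈S)))
                                     (only-at-start only-start (walk lk) u∈k (there u∈S)))
    ... | no u∉S with prefix-avoiding there only-end (walk lf) u∈f u∉S
                    | suffix-avoiding there only-start (walk lk) u∈k u∉S
    ...   | pre , w₁ , avoids₁ | suf , w₂ , avoids₂ =
      no-avoiding-walk S-blocks (start∈A lf) (end∈B lk) (concat-at w₁ w₂) (All-++⁺ avoids₁ avoids₂)

    module Glue (x∉S : x ∉ S) (y∉S : y ∉ S)
                (|T₁|≡1+|S| : length T₁ ≡ suc (length S))
                (|T₂|≡1+|S| : length T₂ ≡ suc (length S)) where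

      fronts : List (Front E A (x ∷ S))
      fronts = map (proj₁ ∘ first-entry) Q₁

      backs : List (Back E (y ∷ S) B)
      backs = map (proj₁ ∘ last-exit) Q₂

      fronts-disjoint : AllPairs (Disjoint on front-verts) fronts
      fronts-disjoint = disjoint-shrink _ (proj₂ ∘ first-entry) Q₁-disjoint

      backs-disjoint : AllPairs (Disjoint on back-verts) backs
      backs-disjoint = disjoint-shrink _ (proj₂ ∘ last-exit) Q₂-disjoint

      -- There are |x ∷ S| disjoint fronts, so every vertex of x ∷ S is the end
      -- of one of them; dually every vertex of y ∷ S starts a back.
      front-at : ∀ {z} → z ∈ x ∷ S → ∃ λ f → f ∈ fronts × front-end f ≡ z
      front-at = disjoint-meeting-onto front-verts _≟_ front-end (x ∷ S) fronts-disjoint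
        (All.tabulate λ {f} _ → end∈ (walk (Front.as-link f)) , end∈B (Front.as-link f))
        (trans (length-map _ Q₁) (trans |Q₁|≡|T₁| |T₁|≡1+|S|))

      back-at : ∀ {z} → z ∈ y ∷ S → ∃ λ k → k ∈ backs × back-start k ≡ z
      back-at = disjoint-meeting-onto back-verts _≟_ back-start (y ∷ S) backs-disjoint
        (All.tabulate λ {k} _ → start∈ (walk (Back.as-link k)) , start∈A (Back.as-link k))
        (trans (length-map _ Q₂) (trans |Q₂|≡|T₂| |T₂|≡1+|S|))

      partner : ∀ {z} → z ∈ x ∷ S → V
      partner (here _)      = y
      partner {z} (there _) = z

      partner∈ : ∀ {z} (z∈ : z ∈ x ∷ S) → partner z∈ ∈ y ∷ S
      partner∈ (here _)    = here refl
      partner∈ (there z∈S) = there z∈S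

      partner-injective : ∀ {z z'} (z∈ : z ∈ x ∷ S) (z'∈ : z' ∈ x ∷ S) → z ≢ z' →
                          partner z∈ ≢ partner z'∈
      partner-injective (here z≡x)  (here z'≡x)  z≢z' _    = z≢z' (trans z≡x (sym z'≡x))
      partner-injective (here _)    (there z'∈S) _    y≡z' = y∉S (subst (_∈ S) (sym y≡z') z'∈S)
      partner-injective (there z∈S) (here _)     _    z≡y  = y∉S (subst (_∈ S) z≡y z∈S)
      partner-injective (there _)   (there _)    z≢z'      = z≢z'

      end≢partner : ∀ {z z'} (z∈ : z ∈ x ∷ S) (z'∈ : z' ∈ x ∷ S) → z ≢ z' → z ≢ partner z'∈
      end≢partner (here z≡x)  (here z'≡x) z≢z' _   = z≢z' (trans z≡x (sym z'≡x))
      end≢partner (there z∈S) (here _)    _    z≡y = y∉S (subst (_∈ S) z≡y z∈S)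
      end≢partner _           (there _)   z≢z'     = z≢z'

      front-of : ∀ {z} → z ∈ x ∷ S → Front E A (x ∷ S)
      front-of = proj₁ ∘ front-at

      front-of-end : ∀ {z} (z∈ : z ∈ x ∷ S) → front-end (front-of z∈) ≡ z
      front-of-end z∈ = proj₂ (proj₂ (front-at z∈))

      back-of : ∀ {z} → z ∈ x ∷ S → Back E (y ∷ S) B
      back-of = proj₁ ∘ back-at ∘ partner∈

      back-of-start : ∀ {z} (z∈ : z ∈ x ∷ S) → back-start (back-of z∈) ≡ partner z∈
      back-of-start z∈ = proj₂ (proj₂ (back-at (partner∈ z∈)))

      join-at : ∀ {z a b ws vs} (z∈ : z ∈ x ∷ S) → Walk E a z ws → Walk E (partner z∈) b vs →
                WalkWithin E⁺ a b (ws ++ vs)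
      join-at (here refl) w₁ w₂ = _ , bridge (weaken w₁) (here refl) (weaken w₂) , id
      join-at (there _)   w₁ w₂ = concat-at (weaken w₁) (weaken w₂)

      glued-walk : ∀ {z} (z∈ : z ∈ x ∷ S) →
                   WalkWithin E⁺ (start (Front.as-link (front-of z∈))) (end (Back.as-link (back-of z∈)))
                                 (front-verts (front-of z∈) ++ back-verts (back-of z∈))
      glued-walk z∈ = join-at z∈ (recast refl (front-of-end z∈) (walk (Front.as-link (front-of z∈))))
                                 (recast (back-of-start z∈) refl (walk (Back.as-link (back-of z∈))))

      glued : ∀ {z} → z ∈ x ∷ S → Link E⁺ A B
      glued z∈ = link _ _ _ (proj₁ (proj₂ (glued-walk z∈)))
                          (start∈A (Front.as-link (front-of z∈))) (end∈B (Back.as-link (back-of z∈)))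

      glued⊆ : ∀ {z} (z∈ : z ∈ x ∷ S) →
               verts (glued z∈) ⊆ front-verts (front-of z∈) ++ back-verts (back-of z∈)
      glued⊆ z∈ = proj₂ (proj₂ (glued-walk z∈))

      fronts-apart : ∀ {z z'} (z∈ : z ∈ x ∷ S) (z'∈ : z' ∈ x ∷ S) → z ≢ z' →
                     Disjoint (front-verts (front-of z∈)) (front-verts (front-of z'∈))
      fronts-apart z∈ z'∈ z≢z' =
        AllPairs-∈ Disjoint.sym fronts-disjoint
          (proj₁ (proj₂ (front-at z∈))) (proj₁ (proj₂ (front-at z'∈)))
          λ f≡f' → z≢z' (trans (sym (front-of-end z∈)) (trans (cong front-end f≡f') (front-of-end z'∈)))

      backs-apart : ∀ {z z'} (z∈ : z ∈ x ∷ S) (z'∈ : z' ∈ x ∷ S) → z ≢ z' →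
                    Disjoint (back-verts (back-of z∈)) (back-verts (back-of z'∈))
      backs-apart z∈ z'∈ z≢z' =
        AllPairs-∈ Disjoint.sym backs-disjoint
          (proj₁ (proj₂ (back-at (partner∈ z∈)))) (proj₁ (proj₂ (back-at (partner∈ z'∈))))
          λ k≡k' → partner-injective z∈ z'∈ z≢z'
                     (trans (sym (back-of-start z∈)) (trans (cong back-start k≡k') (back-of-start z'∈)))

      front-back-apart : ∀ {z z'} (z∈ : z ∈ x ∷ S) (z'∈ : z' ∈ x ∷ S) → z ≢ z' →
                         Disjoint (front-verts (front-of z∈)) (back-verts (back-of z'∈))
      front-back-apart z∈ z'∈ z≢z' = crossing (front-of z∈) (back-of z'∈)
        λ end≡start → end≢partner z∈ z'∈ z≢z'
                        (trans (sym (front-of-end z∈)) (trans end≡start (back-of-start z'∈)))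

      glued-disjoint : ∀ {z z'} (z∈ : z ∈ x ∷ S) (z'∈ : z' ∈ x ∷ S) → z ≢ z' → glued z∈ # glued z'∈
      glued-disjoint z∈ z'∈ z≢z' =
        Disjoint-⊆ (glued⊆ z∈) (glued⊆ z'∈)
          (Disjoint-++ (fronts-apart z∈ z'∈ z≢z') (front-back-apart z∈ z'∈ z≢z')
                       (Disjoint.sym (front-back-apart z'∈ z∈ (z≢z' ∘ sym))) (backs-apart z∈ z'∈ z≢z'))

      glued-pair : MengerPair E⁺ A B
      glued-pair = record
        { separator        = T₁
        ; blocks           = T₁-blocks
        ; separator-unique = T₁-unique
        ; links            = mapWith∈ (x ∷ S) glued
        ; links-disjoint   = mapWith∈-AllPairs {R = _#_} (x ∷ S) glued
                               (¬Any⇒All¬ S x∉S ∷ S-unique) glued-disjoint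
        ; same-size        = trans (length-mapWith∈ (setoid V) (x ∷ S) {glued}) (sym |T₁|≡1+|S|)
        }

    -- In the remaining case x ∈ S would give |T₁| ≤ |S| (and y ∈ S would give
    -- |T₂| ≤ |S|), so x, y ∉ S and |T₁| = |T₂| = |S| + 1.
    menger-step : MengerPair E⁺ A B
    menger-step with length T₁ ≤? length S | length T₂ ≤? length S
    ... | yes |T₁|≤|S| | _           = from-small-separator T₁-blocks T₁-unique |T₁|≤|S|
    ... | no _         | yes |T₂|≤|S| = from-small-separator T₂-blocks T₂-unique |T₂|≤|S|
    ... | no |T₁|≰|S|  | no |T₂|≰|S|  =
      Glue.glued-pair (|T₁|≰|S| ∘ |T₁|≤|x∷S| ∘ absorb) (|T₂|≰|S| ∘ |T₂|≤|y∷S| ∘ absorb)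
        (≤-antisym (|T₁|≤|x∷S| id) (≰⇒> |T₁|≰|S|))
        (≤-antisym (|T₂|≤|y∷S| id) (≰⇒> |T₂|≰|S|))

  menger : ∀ E A B → MengerPair E A B
  menger []            A B = menger-base A B
  menger ((x , y) ∷ E) A B = InductionStep.menger-step x y M (menger E A (x ∷ S)) (menger E (y ∷ S) B)
    where
    M : MengerPair E A B
    M = menger E A B
    S : List V
    S = MengerPair.separator M

increasing-head : ∀ {t ts} → Linked _<_ (t ∷ ts) → All (t <_) ts
increasing-head [-]            = []
increasing-head (t<t' ∷ incr) = Linked⇒All <-trans t<t' incr

prepend : ∀ {t ts} → All (t <_) ts → Linked _<_ ts → Linked _<_ (t ∷ ts)
prepend []          _    = [-]
prepend (t<t' ∷ _) incr = t<t' ∷ incr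

-- ls tt if b holds and [] otherwise; this turns the label function of a
-- temporal graph, which needs a proof that (u , w) is an edge, into a list.
guarded : (b : Bool) → (T b → List ℕ) → List ℕ
guarded true  ls = ls tt
guarded false _  = []

∈-guarded⁻ : ∀ b (ls : T b → List ℕ) {t} → t ∈ guarded b ls → Σ (T b) λ e → t ∈ ls e
∈-guarded⁻ true ls t∈ = tt , t∈

∈-guarded⁺ : ∀ b (ls : T b → List ℕ) {t} (e : T b) → t ∈ ls e → t ∈ guarded b ls
∈-guarded⁺ true ls tt t∈ = t∈

module Expansion {n : ℕ} (G : TemporalGraph n) (s v : Fin n) (s≢v : s ≢ v) where
  open TemporalGraph G

  _≟ᵃ_ : DecidableEquality (NodeTime G)
  _≟ᵃ_ = ≡-dec Fin._≟_ ℕ._≟_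

  open Menger _≟ᵃ_
  open DecMembership ℕ._≟_ using () renaming (_∈?_ to _∈ℕ?_)
  open DecMembership (Fin._≟_ {n}) using () renaming (_∈?_ to _∈ᶠ?_)
  open DecMembership _≟ᵃ_ using () renaming (_∈?_ to _∈ᵃ?_)

  labels : Fin n → Fin n → List ℕ
  labels u w = guarded (Adj u w) (label u w)

  labels⇒time-edge : ∀ {u w t} → t ∈ labels u w → TimeEdge G u w t
  labels⇒time-edge {u} {w} = ∈-guarded⁻ (Adj u w) (label u w)

  time-edge⇒labels : ∀ {u w t} → TimeEdge G u w t → t ∈ labels u w
  time-edge⇒labels {u} {w} (e , t∈) = ∈-guarded⁺ (Adj u w) (label u w) e t∈

  arrival-times : List (NodeTime G)
  arrival-times = concatMap (λ uw → map (proj₂ uw ,_) (labels (proj₁ uw) (proj₂ uw)))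
                            (cartesianProduct (allFin n) (allFin n))

  arrival∈ : ∀ {u w t} → TimeEdge G u w t → (w , t) ∈ arrival-times
  arrival∈ {u} {w} te = ∈-concatMap⁺ _
    (Any.map (λ { refl → ∈-map⁺ (w ,_) (time-edge⇒labels te) })
             (∈-cartesianProduct⁺ (∈-allFin u) (∈-allFin w)))

  Hop : NodeTime G × NodeTime G → Set
  Hop ((u , t) , (w , t')) = t' ∈ labels u w × t < t'

  Hop? : ∀ p → Dec (Hop p)
  Hop? ((u , t) , (w , t')) = (t' ∈ℕ? labels u w) ×-dec (t <? t')

  hops : Edges
  hops = filter Hop? (cartesianProduct arrival-times arrival-times)

  departures-from : Fin n → List (NodeTime G)
  departures-from u = filter (λ a → proj₂ a ∈ℕ? labels u (proj₁ a)) arrival-times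

  sources sinks : List (NodeTime G)
  sources = departures-from s
  sinks   = filter (λ a → proj₁ a Fin.≟ v) arrival-times

  chain-walk : ∀ {w t xs} → (w , t) ∈ arrival-times → Chain G w v xs → Linked _<_ (t ∷ map (time G) xs) →
               ∃ λ b → Walk hops (w , t) b ((w , t) ∷ map (arrival G) xs) × b ∈ sinks
  chain-walk wt∈ []          _              = _ , done , ∈-filter⁺ _ wt∈ refl
  chain-walk wt∈ (te ∷ ch) (t<t' ∷ incr) with chain-walk (arrival∈ te) ch incr
  ... | b , wk , b∈ =
    b , step (∈-filter⁺ Hop? (∈-cartesianProduct⁺ wt∈ (arrival∈ te)) (time-edge⇒labels te , t<t')) wk , b∈

  journey-walk : ∀ {X xs} → JourneyAvoiding G X s v xs →
                 ∃₂ λ a b → Walk hops a b (map (arrival G) xs) × a ∈ sources × b ∈ sinks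
  journey-walk (ch , incr , _) = from-first-hop s≢v ch incr
    where
    from-first-hop : ∀ {u xs} → u ≢ v → Chain G u v xs → Linked _<_ (map (time G) xs) →
                     ∃₂ λ a b → Walk hops a b (map (arrival G) xs) × a ∈ departures-from u × b ∈ sinks
    from-first-hop u≢v []          _    = ⊥-elim (u≢v refl)
    from-first-hop u≢v (te ∷ ch) incr with chain-walk (arrival∈ te) ch incr
    ... | b , wk , b∈ = _ , b , wk , ∈-filter⁺ _ (arrival∈ te) (time-edge⇒labels te) , b∈

  walk-chain : ∀ {w t b ws} → Walk hops (w , t) b ws → b ∈ sinks →
               ∃ λ ys → Chain G w v ys × Linked _<_ (t ∷ map (time G) ys) × map (arrival G) ys ⊆ ws
  walk-chain done b∈ with proj₂ (∈-filter⁻ _ {xs = arrival-times} b∈)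
  ... | refl = [] , [] , [-] , λ ()
  walk-chain (step h wk) b∈ with ∈-filter⁻ Hop? {xs = cartesianProduct arrival-times arrival-times} h
                               | walk-chain wk b∈
  ... | _ , t'∈ , t<t' | ys , ch , incr , ys⊆ =
    _ , labels⇒time-edge t'∈ ∷ ch , t<t' ∷ incr , ∈-∷⁺ʳ (there (start∈ wk)) (there ∘ ys⊆)

  record Erasure (u : Fin n) (xs : List (Step G)) : Set where
    field
      steps        : List (Step G)
      chain        : Chain G u v steps
      increasing   : Linked _<_ (map (time G) steps)
      nodes-unique : Unique (u ∷ map (target G) steps)
      steps⊆       : steps ⊆ xs
  open Erasure

  erasure-⊆ : ∀ {u xs ys} → xs ⊆ ys → Erasure u xs → Erasure u ys
  erasure-⊆ xs⊆ e = record
    { steps = steps e ; chain = chain e ; increasing = increasing e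
    ; nodes-unique = nodes-unique e ; steps⊆ = xs⊆ ∘ steps⊆ e }

  resume : ∀ {w u ys} → Chain G w v ys → u ∈ w ∷ map (target G) ys → Unique (w ∷ map (target G) ys) →
           Linked _<_ (map (time G) ys) → Erasure u ys
  resume ch        (here refl) uniq       incr = record
    { steps = _ ; chain = ch ; increasing = incr ; nodes-unique = uniq ; steps⊆ = id }
  resume (_ ∷ ch) (there u∈)  (_ ∷ uniq) incr = erasure-⊆ there (resume ch u∈ uniq (Linked.tail incr))

  -- Erase the loops of an increasing chain from its end backwards: a step
  -- from u is kept if u does not occur later, and otherwise the erased rest
  -- is resumed at u.
  erase : ∀ {u xs} → Chain G u v xs → Linked _<_ (map (time G) xs) → Erasure u xs
  erase []  _ = record { steps = [] ; chain = [] ; increasing = [] ; nodes-unique = [] ∷ [] ; steps⊆ = id }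
  erase {u} (_∷_ {w = w} {t = t} te ch) incr with erase ch (Linked.tail incr)
  ... | e with u ∈ᶠ? (w ∷ map (target G) (steps e))
  ...   | yes u∈ = erasure-⊆ (there ∘ steps⊆ e) (resume (chain e) u∈ (nodes-unique e) (increasing e))
  ...   | no u∉  = record
    { steps        = (u , w , t) ∷ steps e
    ; chain        = te ∷ chain e
    ; increasing   = prepend (map⁺ (anti-mono (steps⊆ e) (map⁻ (increasing-head incr))))
                             (increasing e)
    ; nodes-unique = ¬Any⇒All¬ _ u∉ ∷ nodes-unique e
    ; steps⊆       = ∷⁺ʳ _ (steps⊆ e)
    }

  link-journey : (l : Link hops sources sinks) → ∃ λ xs → Journey G s v xs × map (arrival G) xs ⊆ verts l
  link-journey (link (w , t) b ws wk a∈ b∈) with walk-chain wk b∈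
  ... | ys , ch , incr , ys⊆
    with erase (labels⇒time-edge (proj₂ (∈-filter⁻ _ {xs = arrival-times} a∈)) ∷ ch) incr
  ... | e = steps e , (chain e , increasing e , nodes-unique e , All.tabulate λ _ ()) ,
            ∈-∷⁺ʳ (start∈ wk) ys⊆ ∘ map-⊆ (arrival G) (steps⊆ e)


  expansion-separator-meets : ∀ {X Y xs} → Blocks hops sources sinks X →
                              JourneyAvoiding G Y s v xs → Meets (map (arrival G) xs) X
  expansion-separator-meets X-blocks j with journey-walk j
  ... | a , b , wk , a∈ , b∈ = X-blocks wk a∈ b∈

  expansion-separator-separates : ∀ {X} → Blocks hops sources sinks X → Separates G X s v
  expansion-separator-separates X-blocks xs j@(_ , _ , _ , avoids)
    with expansion-separator-meets X-blocks j
  ... | a , a∈ , a∈X with ∈-map⁻ (arrival G) a∈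
  ...   | st , st∈ , refl = All.lookup avoids st∈ a∈X

  separator-meets : ∀ {X xs} → Separates G X s v → Journey G s v xs → Meets (map (arrival G) xs) X
  separator-meets {X} {xs} X-separates (ch , incr , uniq , _) with any? (λ st → arrival G st ∈ᵃ? X) xs
  ... | yes hit = let st , st∈ , a∈X = find hit in arrival G st , ∈-map⁺ (arrival G) st∈ , a∈X
  ... | no miss = ⊥-elim (X-separates xs (ch , incr , uniq , ¬Any⇒All¬ xs miss))

  journeys-≤ : ∀ {js X} → InDisjointJourneys G s v js →
               (∀ {xs} → Journey G s v xs → Meets (map (arrival G) xs) X) → length js ≤ length X
  journeys-≤ (journeys , in-disjoint) meets =
    disjoint-meeting-≤ (map (arrival G)) _ (AllPairs.map (λ j#k {a} (a∈ , a∈') → j#k a a∈ a∈') in-disjoint)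
                       (All.map meets journeys)

  link-journeys : ∀ {Ls} → AllPairs _#_ Ls → InDisjointJourneys G s v (map (proj₁ ∘ link-journey) Ls)
  link-journeys disjoint =
    map⁺ (All.tabulate λ {l} _ → proj₁ (proj₂ (link-journey l))) ,
    AllPairs.map⁺ (AllPairs.map (λ {l} {k} l#k a a∈ a∈' →
      l#k (proj₂ (proj₂ (link-journey l)) a∈ , proj₂ (proj₂ (link-journey k)) a∈')) disjoint)

corollary1 : ∀ {n} (G : TemporalGraph n) (s v : Fin n) → s ≢ v →
    ∃ λ (k : ℕ) → IsMaxInDisjoint G s v k × IsMinSeparator G s v k
corollary1 G s v s≢v =
  length X ,
  ((journeys , link-journeys links-disjoint , |journeys|≡|X|) ,
   λ js in-disjoint → journeys-≤ in-disjoint (expansion-separator-meets blocks)) ,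
  ((X , expansion-separator-separates blocks , refl) ,
   λ Y Y-separates → subst (_≤ length Y) |journeys|≡|X|
                       (journeys-≤ (link-journeys links-disjoint) (separator-meets Y-separates)))
  where
  open Expansion G s v s≢v
  open Menger _≟ᵃ_ using (menger; module MengerPair)
  open MengerPair (menger hops sources sinks) renaming (separator to X)

  journeys : List (List (Step G))
  journeys = map (proj₁ ∘ link-journey) links

  |journeys|≡|X| : length journeys ≡ length X
  |journeys|≡|X| = trans (length-map _ links) same-size
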